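{- Let $G=(V,E)$ be a graph with a proper $k$-coloring $\chi$, let $e\in E$, let $\ell\ge1$, and let $\sigma$ be an ordering of $E$. Then the radius-$\ell$ visible neighborhood of $e$ in $G$ given $\sigma$ equals the radius-$\ell$ visible neighborhood of $e$ in $G[N]$ given the induced ordering $\sigma[N]$, where $N=B_G(\ell,e)$.
   Context: A graph is a directed multigraph $G=(V,E)$: $V$ finite, $E$ a finite multiset of ordered pairs $(u,v)$, $u\ne v$; $\mathrm{verts}((u,v))=\{u,v\}$. Paths ignore direction; $B_H(r,w)$ is the set of vertices joined to $w$ by a path of length at most $r$ in $H$; for an edge $e=(u,v)$, $B_H(r,e)=B_H(r,u)\cup B_H(r,v)$. $G[U]$ is the induced subgraph on $U$ (edges with both endpoints in $U$, with multiplicity). An ordering of $E$ (with $|E|=m$) is a sequence $\sigma(1),\dots,\sigma(m)$ listing each edge as many times as its multiplicity; the induced ordering $\sigma[U]$ is the subsequence consisting of the edges with both endpoints in $U$. The radius-$\ell$ visible neighborhood of $e=(u,v)$ in $G$ given $\sigma$ is the graph $(\overline V,\overline E)$ produced by: start with $\overline V=\{u,v\}$, $\overline E=\emptyset$ (multiset); for $i=1,\dots,m$, if $\mathrm{verts}(\sigma(i))\cap B_{(\overline V,\overline E)}(\ell-1,e)\ne\emptyset$, add $\sigma(i)$ to $\overline E$ and $\mathrm{verts}(\sigma(i))$ to $\overline V$. -}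

module Defs where

open import Data.Nat using (ℕ; zero; suc; _∸_)
open import Data.Fin using (Fin; _≟_)
open import Data.Bool using (Bool; true; false; _∨_; _∧_; if_then_else_)
open import Data.Product using (_×_; _,_; proj₁; proj₂)
open import Data.List using (List; []; _∷_; filter; _∷ʳ_)
open import Data.Bool.ListAction using (any)
open import Relation.Nullary.Decidable using (⌊_⌋)
open import Relation.Binary.PropositionalEquality using (_≡_)
open import Data.Bool using (T)

-- Vertices of every graph are (a subset of) Fin n; an edge is an ordered pair.
Edge : ℕ → Set
Edge n = Fin n × Fin n

_=ᵥ_ : ∀ {n} → Fin n → Fin n → Bool
x =ᵥ y = ⌊ x ≟ y ⌋

incident : ∀ {n} → Fin n → Edge n → Bool
incident x (a , b) = (x =ᵥ a) ∨ (x =ᵥ b)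

-- Equivalently: there is a path of
-- length ≤ r from w to x (paths ignore direction).
ball : ∀ {n} → List (Edge n) → ℕ → Fin n → Fin n → Bool
ball es zero w x = x =ᵥ w
ball es (suc r) w x =
  ball es r w x ∨
  any (λ { (a , b) → ((x =ᵥ a) ∧ ball es r w b) ∨ ((x =ᵥ b) ∧ ball es r w a) }) es

ballE : ∀ {n} → List (Edge n) → ℕ → Edge n → Fin n → Bool
ballE es r (u , v) x = ball es r u x ∨ ball es r v x

VertexSet : ℕ → Set
VertexSet n = Fin n → Bool

visibleStep : ∀ {n} → ℕ → Edge n → VertexSet n × List (Edge n) → Edge n
            → VertexSet n × List (Edge n)
visibleStep ℓ e (V̄ , Ē) f =
  if (ballE Ē (ℓ ∸ 1) e (proj₁ f) ∨ ballE Ē (ℓ ∸ 1) e (proj₂ f))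
  then ((λ x → V̄ x ∨ incident x f) , Ē ∷ʳ f)
  else (V̄ , Ē)

visibleLoop : ∀ {n} → ℕ → Edge n → VertexSet n × List (Edge n) → List (Edge n)
            → VertexSet n × List (Edge n)
visibleLoop ℓ e st [] = st
visibleLoop ℓ e st (f ∷ σ) = visibleLoop ℓ e (visibleStep ℓ e st f) σ

visible : ∀ {n} → ℕ → Edge n → List (Edge n) → VertexSet n × List (Edge n)
visible ℓ e σ = visibleLoop ℓ e ((λ x → incident x e) , []) σ

induced : ∀ {n} → VertexSet n → List (Edge n) → List (Edge n)
induced U σ = filter (λ f → T? (U (proj₁ f) ∧ U (proj₂ f))) σ
  where
  open import Data.Bool.Properties using () renaming (T? to T?)

ProperColoring : ∀ {n} (k : ℕ) → List (Edge n) → (Fin n → Fin k) → Set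
ProperColoring k E χ = ∀ {u v} → (u , v) ∈ E → ¬ (χ u ≡ χ v)
  where
  open import Data.List.Membership.Propositional using (_∈_)
  open import Relation.Nullary using (¬_)

Loopless : ∀ {n} → List (Edge n) → Set
Loopless E = ∀ {u v} → (u , v) ∈ E → ¬ (u ≡ v)
  where
  open import Data.List.Membership.Propositional using (_∈_)
  open import Relation.Nullary using (¬_)

-- An edge f is admitted to the visible neighbourhood only if one of its endpoints lies in
-- B_Ē(ℓ-1, e) for the edges Ē admitted so far.  As Ē ⊆ E, that endpoint lies in B_G(ℓ-1, e),
-- so both endpoints of f lie in N = B_G(ℓ, e).  Every edge outside G[N] is therefore rejected
-- and leaves the state unchanged, so deleting those edges from σ does not change the run:
-- the two runs produce literally the same vertex set and the same edge list.
module Submission where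

open import Defs
open import Data.Nat using (ℕ; _≥_; suc; _∸_; s≤s)
open import Data.Fin using (Fin)
open import Data.Bool using (Bool; true; false; _∨_; _∧_; T)
open import Data.Bool.Properties using (T?; T-∨; T-∧)
open import Data.Sum as Sum using (_⊎_; inj₁; inj₂)
open import Data.Product using (_×_; _,_; proj₁; proj₂)
open import Data.List using (List; []; _∷_)
open import Data.List.Relation.Unary.Any as Any using (here; there)
open import Data.List.Relation.Unary.Any.Properties using (any⁺; any⁻)
open import Data.List.Membership.Propositional using (_∈_)
open import Data.List.Membership.Propositional.Properties using (∈-++⁻)
open import Data.List.Relation.Binary.Subset.Propositional using (_⊆_)
open import Data.List.Relation.Binary.Subset.Propositional.Properties using (Any-resp-⊆)
open import Data.List.Relation.Binary.Permutation.Propositional using (_↭_; ↭-reflexive)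
open import Data.List.Relation.Binary.Permutation.Propositional.Properties using (∈-resp-↭)
open import Data.List.Properties using (filter-accept; filter-reject)
open import Function using (_∘_; id; Equivalence)
open import Relation.Nullary using (¬_; Dec; yes; no; contradiction)
open import Relation.Nullary.Decidable using (fromWitness)
open import Relation.Binary.PropositionalEquality using (_≡_; refl; sym; cong; module ≡-Reasoning)

open Equivalence using (to; from)

∨-map : ∀ {a b c d} → (T a → T c) → (T b → T d) → T (a ∨ b) → T (c ∨ d)
∨-map f g = from T-∨ ∘ Sum.map f g ∘ to T-∨

∧-mapʳ : ∀ a {b c} → (T b → T c) → T (a ∧ b) → T (a ∧ c)
∧-mapʳ true  f = f
∧-mapʳ false f = λ ()

Adjacent : ∀ {n} → List (Edge n) → Fin n → Fin n → Set
Adjacent es x y = (x , y) ∈ es ⊎ (y , x) ∈ es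

ball-mono : ∀ {n} {es es' : List (Edge n)} → es ⊆ es' →
            ∀ r {w x} → T (ball es r w x) → T (ball es' r w x)
ball-mono es⊆es' 0 = id
ball-mono {n} {es} {es'} es⊆es' (suc r) {w} {x} =
  ∨-map (ball-mono es⊆es' r)
        (any⁺ (joins es') ∘ Any-resp-⊆ es⊆es' ∘ Any.map (joins-mono _) ∘ any⁻ (joins es) es)
  where
  joins : List (Edge n) → Edge n → Bool
  joins hs (a , b) = ((x =ᵥ a) ∧ ball hs r w b) ∨ ((x =ᵥ b) ∧ ball hs r w a)

  joins-mono : ∀ f → T (joins es f) → T (joins es' f)
  joins-mono (a , b) =
    ∨-map (∧-mapʳ (x =ᵥ a) (ball-mono es⊆es' r)) (∧-mapʳ (x =ᵥ b) (ball-mono es⊆es' r))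

ball-suc : ∀ {n} {es : List (Edge n)} {r w x} → T (ball es r w x) → T (ball es (suc r) w x)
ball-suc = from T-∨ ∘ inj₁

ball-adjacent : ∀ {n} {es : List (Edge n)} {r w x y} → Adjacent es x y →
                T (ball es r w x) → T (ball es (suc r) w y)
ball-adjacent {es = es} {r} {w} {x} {y} adj x∈B = from T-∨ (inj₂ (any⁺ _ (witness adj)))
  where
  at-y : ∀ {z} → z ≡ y → T ((y =ᵥ z) ∧ ball es r w x)
  at-y refl = from T-∧ (fromWitness refl , x∈B)

  witness : Adjacent es x y → Any.Any _ es
  witness (inj₁ xy∈es) = Any.map (λ { refl → from T-∨ (inj₂ (at-y refl)) }) xy∈es
  witness (inj₂ yx∈es) = Any.map (λ { refl → from T-∨ (inj₁ (at-y refl)) }) yx∈es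

ballE-map : ∀ {n} {es es' : List (Edge n)} {r r' x y} →
            (∀ {w} → T (ball es r w x) → T (ball es' r' w y)) →
            ∀ e → T (ballE es r e x) → T (ballE es' r' e y)
ballE-map f (u , v) = ∨-map f f

ballE-mono : ∀ {n} {es es' : List (Edge n)} {x} → es ⊆ es' →
             ∀ r e → T (ballE es r e x) → T (ballE es' r e x)
ballE-mono {es = es} {es'} es⊆es' r = ballE-map {es = es} {es'} {r} {r} (ball-mono es⊆es' r)

ballE-suc : ∀ {n} (es : List (Edge n)) {x} r e → T (ballE es r e x) → T (ballE es (suc r) e x)
ballE-suc es r = ballE-map {es = es} {es} {r} {suc r} (λ {w} → ball-suc {es = es} {r} {w})

ballE-adjacent : ∀ {n} {es : List (Edge n)} {x y} → Adjacent es x y →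
                 ∀ r e → T (ballE es r e x) → T (ballE es (suc r) e y)
ballE-adjacent {es = es} adj r = ballE-map {es = es} {es} {r} {suc r} (λ {w} → ball-adjacent {r = r} {w} adj)

Admits : ∀ {n} → ℕ → Edge n → List (Edge n) → Edge n → Bool
Admits ℓ e Ē (a , b) = ballE Ē (ℓ ∸ 1) e a ∨ ballE Ē (ℓ ∸ 1) e b

admitted⇒endpoints-in-ball : ∀ {n} {E Ē : List (Edge n)} r e {a b} → Ē ⊆ E → (a , b) ∈ E →
  T (Admits (suc r) e Ē (a , b)) → T (ballE E (suc r) e a ∧ ballE E (suc r) e b)
admitted⇒endpoints-in-ball {E = E} r e Ē⊆E ab∈E admits
  with to T-∨ admits
... | inj₁ a∈B = from T-∧ (ballE-suc E r e a∈G , ballE-adjacent (inj₁ ab∈E) r e a∈G)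
  where a∈G = ballE-mono Ē⊆E r e a∈B
... | inj₂ b∈B = from T-∧ (ballE-adjacent (inj₂ ab∈E) r e b∈G , ballE-suc E r e b∈G)
  where b∈G = ballE-mono Ē⊆E r e b∈B

visibleStep-rejects : ∀ {n} ℓ (e : Edge n) {V̄ Ē f} → ¬ T (Admits ℓ e Ē f) →
                      visibleStep ℓ e (V̄ , Ē) f ≡ (V̄ , Ē)
visibleStep-rejects ℓ e {Ē = Ē} {f} ¬admits with Admits ℓ e Ē f
... | true  = contradiction _ ¬admits
... | false = refl

visibleStep-⊆ : ∀ {n} {E : List (Edge n)} ℓ e {V̄ Ē f} → Ē ⊆ E → f ∈ E →
                proj₂ (visibleStep ℓ e (V̄ , Ē) f) ⊆ E
visibleStep-⊆ ℓ e {Ē = Ē} {f} Ē⊆E f∈E with Admits ℓ e Ē f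
... | false = Ē⊆E
... | true  = Sum.[ Ē⊆E , (λ { (here refl) → f∈E }) ] ∘ ∈-++⁻ Ē

module _ {n} (E : List (Edge n)) (r : ℕ) (e : Edge n) where
  private
    ℓ = suc r
    N = ballE E ℓ e

    inN? : (g : Edge n) → Dec (T (N (proj₁ g) ∧ N (proj₂ g)))
    inN? g = T? (N (proj₁ g) ∧ N (proj₂ g))

  visibleLoop-induced : ∀ st (σ : List (Edge n)) → proj₂ st ⊆ E → σ ⊆ E →
                        visibleLoop ℓ e st σ ≡ visibleLoop ℓ e st (induced N σ)
  visibleLoop-induced st [] _ _ = refl
  visibleLoop-induced st@(V̄ , Ē) (f ∷ σ) Ē⊆E fσ⊆E with inN? f
  ... | yes f∈G[N] = begin
    visibleLoop ℓ e (visibleStep ℓ e st f) σ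
      ≡⟨ visibleLoop-induced _ σ (visibleStep-⊆ ℓ e Ē⊆E (fσ⊆E (here refl))) (fσ⊆E ∘ there) ⟩
    visibleLoop ℓ e st (f ∷ induced N σ)
      ≡⟨ cong (visibleLoop ℓ e st) (sym (filter-accept inN? f∈G[N])) ⟩
    visibleLoop ℓ e st (induced N (f ∷ σ)) ∎
    where open ≡-Reasoning
  ... | no f∉G[N] = begin
    visibleLoop ℓ e (visibleStep ℓ e st f) σ
      ≡⟨ cong (λ st' → visibleLoop ℓ e st' σ) (visibleStep-rejects ℓ e rejected) ⟩
    visibleLoop ℓ e st σ
      ≡⟨ visibleLoop-induced st σ Ē⊆E (fσ⊆E ∘ there) ⟩
    visibleLoop ℓ e st (induced N σ)
      ≡⟨ cong (visibleLoop ℓ e st) (sym (filter-reject inN? f∉G[N])) ⟩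
    visibleLoop ℓ e st (induced N (f ∷ σ)) ∎
    where
    open ≡-Reasoning
    rejected : ¬ T (Admits ℓ e Ē f)
    rejected = f∉G[N] ∘ admitted⇒endpoints-in-ball r e Ē⊆E (fσ⊆E (here refl))

proposition6p5 : (n k : ℕ) (E : List (Edge n)) → Loopless E
    → (χ : Fin n → Fin k) → ProperColoring k E χ
    → (e : Edge n) → e ∈ E → (ℓ : ℕ) → ℓ ≥ 1
    → (σ : List (Edge n)) → σ ↭ E
    → let N = ballE E ℓ e
          VG = visible ℓ e σ
          VN = visible ℓ e (induced N σ)
      in ((x : Fin n) → proj₁ VG x ≡ proj₁ VN x) × (proj₂ VG ↭ proj₂ VN)
proposition6p5 n k E _ χ _ e _ (suc r) (s≤s _) σ σ↭E =
  (λ x → cong (λ st → proj₁ st x) same-run) , ↭-reflexive (cong proj₂ same-run)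
  where
  same-run : visible (suc r) e σ ≡ visible (suc r) e (induced (ballE E (suc r) e) σ)
  same-run = visibleLoop-induced E r e _ σ (λ ()) (∈-resp-↭ σ↭E)
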